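{- Let $T$ be a complete first order theory with big model $\mathcal M$. For all small $A,B,C\subseteq M$, if $A\perp^c_C B$ then $A\perp^a_C B$ in $\mathcal M$.
   Context: A set is small if its cardinality is less than that of the big (saturated) model $\mathcal M$. $A\perp^a_C B$ means $\operatorname{acl}^{\mathcal M}(A\cup C)\cap\operatorname{acl}^{\mathcal M}(B\cup C)=\operatorname{acl}^{\mathcal M}(C)$. $A\perp^c_C B$ ("$C$ covers $A$ in $B$") means: for every first order formula $\varphi(\bar x,\bar y,\bar z)$ and all tuples $\bar a\in A^{|\bar x|}$, $\bar b\in B^{|\bar y|}$, $\bar c\in C^{|\bar z|}$, there exists $\bar d\in C^{|\bar y|}$ such that if $\mathcal M\models\varphi(\bar a,\bar b,\bar c)$ then $\mathcal M\models\varphi(\bar a,\bar d,\bar c)$. -}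

module Defs where

open import Data.Nat using (ℕ; zero; suc; _+_)
open import Data.Fin using (Fin)
open import Data.Vec using (Vec; []; _∷_; _++_; lookup)
open import Data.Vec.Relation.Unary.All using (All)
open import Data.List using (List)
import Data.List.Relation.Unary.All as ListAll
open import Data.List.Membership.Propositional using (_∈_)
open import Data.Product using (Σ; _×_; _,_; ∃; proj₁)
open import Data.Empty using (⊥)
open import Level using (0ℓ)
open import Relation.Nullary using (¬_)
open import Relation.Unary using (Pred; _∪_; _∩_; _⊆_)
open import Relation.Binary.PropositionalEquality using (_≡_)
open import Function.Definitions using (Injective)

record Signature : Set₁ where
  field
    Fun : ℕ → Set
    Rel : ℕ → Set

module _ (L : Signature) where
  open Signature L

  data Term (n : ℕ) : Set where
    var : Fin n → Term n
    app : ∀ {k} → Fun k → Vec (Term n) k → Term n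

  data Formula (n : ℕ) : Set where
    falsum : Formula n
    equal  : Term n → Term n → Formula n
    rel    : ∀ {k} → Rel k → Vec (Term n) k → Formula n
    neg    : Formula n → Formula n
    conj   : Formula n → Formula n → Formula n
    exists : Formula (suc n) → Formula n   -- binds variable 0

  record Structure : Set₁ where
    field
      Carrier : Set
      funI    : ∀ {k} → Fun k → Vec Carrier k → Carrier
      relI    : ∀ {k} → Rel k → Vec Carrier k → Set

module Semantics {L : Signature} (M : Structure L) where
  open Structure M renaming (Carrier to |M|)

  mutual
    evalT : ∀ {n} → Vec |M| n → Term L n → |M|
    evalT ρ (var i)    = lookup ρ i
    evalT ρ (app f ts) = funI f (evalTs ρ ts)

    evalTs : ∀ {n k} → Vec |M| n → Vec (Term L n) k → Vec |M| k
    evalTs ρ []       = []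
    evalTs ρ (t ∷ ts) = evalT ρ t ∷ evalTs ρ ts

  Sat : ∀ {n} → Formula L n → Vec |M| n → Set
  Sat falsum       ρ = ⊥
  Sat (equal s t)  ρ = evalT ρ s ≡ evalT ρ t
  Sat (rel R ts)   ρ = relI R (evalTs ρ ts)
  Sat (neg φ)      ρ = ¬ Sat φ ρ
  Sat (conj φ ψ)   ρ = Sat φ ρ × Sat ψ ρ
  Sat (exists φ)   ρ = Σ |M| λ m → Sat φ (m ∷ ρ)

  Subset : Set₁
  Subset = Pred |M| 0ℓ

  -- X is small: |X| < |M|, i.e. there is no injection of M into X
  Small : Subset → Set
  Small X = ¬ (Σ (|M| → Σ |M| X) λ f → Injective _≡_ _≡_ f)

  -- a formula φ(x, ȳ) in one free variable x together with parameters for ȳ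
  ParamFormula : Set
  ParamFormula = Σ ℕ λ n → Formula L (suc n) × Vec |M| n

  params : (ψ : ParamFormula) → Vec |M| (proj₁ ψ)
  params (n , φ , p) = p

  SatP : |M| → ParamFormula → Set
  SatP b (n , φ , p) = Sat φ (b ∷ p)

  Saturated : Set₁
  Saturated =
    (X : Subset) → Small X →
    (P : Pred ParamFormula 0ℓ) →
    (∀ ψ → P ψ → All X (params ψ)) →
    ((Φ : List ParamFormula) → ListAll.All P Φ →
        Σ |M| λ b → ListAll.All (SatP b) Φ) →
    Σ |M| λ b → ∀ ψ → P ψ → SatP b ψ

  acl : Subset → Subset
  acl X b =
    Σ ℕ λ n → Σ (Formula L (suc n)) λ φ → Σ (Vec |M| n) λ p →
      All X p × Sat φ (b ∷ p) ×
      Σ (List |M|) λ l → ∀ x → Sat φ (x ∷ p) → x ∈ l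

  IndepA : Subset → Subset → Subset → Set
  IndepA A B C =
    (acl (A ∪ C) ∩ acl (B ∪ C) ⊆ acl C) × (acl C ⊆ acl (A ∪ C) ∩ acl (B ∪ C))

  -- A ⊥^c_C B : C covers A in B
  Covers : Subset → Subset → Subset → Set
  Covers A B C =
    ∀ {i j k} (φ : Formula L (i + (j + k)))
      (a : Vec |M| i) (b : Vec |M| j) (c : Vec |M| k) →
      All A a → All B b → All C c →
      Σ (Vec |M| j) λ d → All C d ×
        (Sat φ (a ++ (b ++ c)) → Sat φ (a ++ (d ++ c)))

-- Let e ∈ acl(AC) ∩ acl(BC).  Choose an algebraic formula ψ(x, ā) over AC
-- true of e with as few solutions as possible, and an algebraic formula
-- φ(x, b̄) over BC true of e, with at most n solutions.  The formula
-- θ(ā, b̄) = ∃x (ψ(x, ā) ∧ φ(x, b̄)) ∧ ∃^{≤n} x φ(x, b̄) holds, so covering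
-- yields d̄ in C with θ(ā, d̄): φ(x, d̄) is algebraic and shares a solution e'
-- with ψ(x, ā).  By minimality ψ(x, ā) isolates the type of e over AC (else
-- conjoining a formula separating e from e' gives fewer solutions), hence
-- φ(e, d̄) holds and e ∈ acl(C).
module Submission where

open import Defs
open import Axiom.ExcludedMiddle using (ExcludedMiddle)
open import Axiom.DoubleNegationElimination using (em⇒dne)
open import Level using (0ℓ)
open import Function using (_∘_; _⇔_; mk⇔; Equivalence)
open import Data.Nat using (ℕ; zero; suc; _+_; _<_)
open import Data.Nat.Induction using (<-rec)
open import Data.Fin using (Fin; zero; suc; _↑ˡ_; _↑ʳ_; lift; splitAt)
open import Data.Vec using (Vec; []; _∷_; _++_; lookup; tabulate; toList; fromList)
open import Data.Vec.Functional using () renaming (_∷_ to _∷ᶠ_; _++_ to _++ᶠ_)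
open import Data.Vec.Properties using (lookup-++ˡ; lookup-++ʳ; lookup-splitAt; lookup∘tabulate)
open import Data.Vec.Relation.Unary.All using (All; []; _∷_)
import Data.Vec.Relation.Unary.All as All
open import Data.Vec.Relation.Unary.All.Properties using (++⁺; lookup⁺; tabulate⁺)
import Data.Vec.Relation.Unary.Any as VecAny
open import Data.Vec.Relation.Unary.Any.Properties using (lookup-index)
open import Data.Vec.Membership.Propositional using () renaming (_∈_ to _∈ᵥ_)
open import Data.Vec.Membership.Propositional.Properties using (∈-lookup; ∈-toList⁺; ∈-fromList⁺)
open import Data.List using (List; length; filter)
import Data.List.Relation.Unary.Any as ListAny
open import Data.List.Properties using (filter-notAll)
open import Data.List.Membership.Propositional using (_∈_)
open import Data.List.Membership.Propositional.Properties using (∈-filter⁺)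
open import Data.Product using (Σ; ∃-syntax; _×_; _,_; <_,_>; proj₁; proj₂)
open import Data.Product.Function.NonDependent.Propositional using (_×-⇔_)
open import Data.Sum using (inj₁; inj₂; [_,_])
open import Data.Sum.Properties using ([,]-∘; [,]-cong)
open import Relation.Nullary using (¬_; yes; no; ¬?)
open import Relation.Unary using (_∪_; _∩_; _⊆_)
open import Relation.Binary.PropositionalEquality
  using (_≡_; _≗_; refl; sym; trans; cong; cong₂; subst; module ≡-Reasoning)
open ≡-Reasoning

open Equivalence using (to; from)

module _ {L : Signature} where

  mutual
    renameTerm : ∀ {n m} → (Fin n → Fin m) → Term L n → Term L m
    renameTerm f (var i)    = var (f i)
    renameTerm f (app g ts) = app g (renameTerms f ts)

    renameTerms : ∀ {n m k} → (Fin n → Fin m) → Vec (Term L n) k → Vec (Term L m) k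
    renameTerms f []       = []
    renameTerms f (t ∷ ts) = renameTerm f t ∷ renameTerms f ts

  rename : ∀ {n m} → (Fin n → Fin m) → Formula L n → Formula L m
  rename f falsum      = falsum
  rename f (equal s t) = equal (renameTerm f s) (renameTerm f t)
  rename f (rel R ts)  = rel R (renameTerms f ts)
  rename f (neg φ)     = neg (rename f φ)
  rename f (conj φ ψ)  = conj (rename f φ) (rename f ψ)
  rename f (exists φ)  = exists (rename (lift 1 f) φ)

  _∨_ : ∀ {n} → Formula L n → Formula L n → Formula L n
  φ ∨ ψ = neg (conj (neg φ) (neg ψ))

  ⋁ : ∀ k {n} → (Fin k → Formula L n) → Formula L n
  ⋁ zero    F = falsum
  ⋁ (suc k) F = F zero ∨ ⋁ k (F ∘ suc)

  existsⁿ : ∀ k {n} → Formula L (k + n) → Formula L n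
  existsⁿ zero    φ = φ
  existsⁿ (suc k) φ = existsⁿ k (exists φ)

  _∧++_ : ∀ {p q} → Formula L (suc p) → Formula L (suc q) → Formula L (suc (p + q))
  _∧++_ {p} {q} ψ χ = conj (rename (lift 1 (_↑ˡ q)) ψ) (rename (lift 1 (p ↑ʳ_)) χ)

  -- x = z₁ ∨ … ∨ x = z_k, in the variables x, z̄ and n further ones
  isAmong : ∀ k {n} → Formula L (suc (k + n))
  isAmong k {n} = ⋁ k λ i → equal (var zero) (var (suc (i ↑ˡ n)))

  atMost : ∀ k {n} → Formula L (suc n) → Formula L n
  atMost k φ = existsⁿ k (neg (exists (conj (rename (lift 1 (k ↑ʳ_)) φ) (neg (isAmong k)))))

module _ {L : Signature} (M : Structure L) where
  open Structure M renaming (Carrier to |M|)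
  open Semantics M using (evalT; evalTs; Sat; Subset; acl; Covers)

  -- ρ = ρ′ ∘ f, as a record so that f, ρ′ and ρ can be inferred from it
  record Agree {n m} (f : Fin n → Fin m) (ρ′ : Vec |M| m) (ρ : Vec |M| n) : Set where
    constructor agree
    field at : lookup ρ′ ∘ f ≗ lookup ρ
  open Agree

  agree-∘ : ∀ {l m n} {g : Fin m → Fin l} {f : Fin n → Fin m} {ρ″ ρ′ ρ} →
    Agree g ρ″ ρ′ → Agree f ρ′ ρ → Agree (g ∘ f) ρ″ ρ
  agree-∘ {f = f} ag ag′ = agree λ t → trans (at ag (f t)) (at ag′ t)

  agree-∷ : ∀ {m n} {j : Fin m} {f : Fin n → Fin m} {ρ′ x ρ} →
    lookup ρ′ j ≡ x → Agree f ρ′ ρ → Agree (j ∷ᶠ f) ρ′ (x ∷ ρ)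
  agree-∷ eq ag = agree λ where
    zero    → eq
    (suc t) → at ag t

  agree-++ : ∀ {k m n} {f : Fin k → Fin m} {g : Fin n → Fin m} {ρ′ a b} →
    Agree f ρ′ a → Agree g ρ′ b → Agree (f ++ᶠ g) ρ′ (a ++ b)
  agree-++ {k} {f = f} {g} {ρ′} {a} {b} agf agg = agree λ t → begin
    lookup ρ′ ([ f , g ] (splitAt k t))             ≡⟨ [,]-∘ (lookup ρ′) (splitAt k t) ⟩
    [ lookup ρ′ ∘ f , lookup ρ′ ∘ g ] (splitAt k t) ≡⟨ [,]-cong (at agf) (at agg) (splitAt k t) ⟩
    [ lookup a , lookup b ] (splitAt k t)           ≡⟨ sym (lookup-splitAt k a b t) ⟩
    lookup (a ++ b) t                               ∎

  agree-lift : ∀ {m n} {f : Fin n → Fin m} {ρ′ ρ} x →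
    Agree f ρ′ ρ → Agree (lift 1 f) (x ∷ ρ′) (x ∷ ρ)
  agree-lift x ag = agree λ where
    zero    → refl
    (suc t) → at ag t

  agree-suc : ∀ {n x} (ρ : Vec |M| n) → Agree suc (x ∷ ρ) ρ
  agree-suc ρ = agree λ _ → refl

  agree-↑ˡ : ∀ {m n} (a : Vec |M| m) (b : Vec |M| n) → Agree (_↑ˡ n) (a ++ b) a
  agree-↑ˡ a b = agree (lookup-++ˡ a b)

  agree-↑ʳ : ∀ {m n} (a : Vec |M| m) (b : Vec |M| n) → Agree (m ↑ʳ_) (a ++ b) b
  agree-↑ʳ a b = agree (lookup-++ʳ a b)

  agree-tabulate : ∀ {m n} (f : Fin n → Fin m) ρ → Agree f ρ (tabulate (lookup ρ ∘ f))
  agree-tabulate f ρ = agree λ t → sym (lookup∘tabulate (lookup ρ ∘ f) t)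

  module _ {n m} {f : Fin n → Fin m} {ρ′ ρ} (ag : Agree f ρ′ ρ) where
    mutual
      evalT-rename : ∀ t → evalT ρ′ (renameTerm f t) ≡ evalT ρ t
      evalT-rename (var i)    = at ag i
      evalT-rename (app g ts) = cong (funI g) (evalTs-rename ts)

      evalTs-rename : ∀ {k} (ts : Vec (Term L n) k) →
        evalTs ρ′ (renameTerms f ts) ≡ evalTs ρ ts
      evalTs-rename []       = refl
      evalTs-rename (t ∷ ts) = cong₂ _∷_ (evalT-rename t) (evalTs-rename ts)

  sat-rename : ∀ {n m} {f : Fin n → Fin m} {ρ′ ρ} → Agree f ρ′ ρ →
    ∀ φ → Sat (rename f φ) ρ′ ⇔ Sat φ ρ
  sat-rename ag falsum      = mk⇔ (λ ()) (λ ())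
  sat-rename ag (equal s t) = mk⇔
    (λ eq → trans (sym (evalT-rename ag s)) (trans eq (evalT-rename ag t)))
    (λ eq → trans (evalT-rename ag s) (trans eq (sym (evalT-rename ag t))))
  sat-rename ag (rel R ts)  = mk⇔ (subst (relI R) (evalTs-rename ag ts))
                                  (subst (relI R) (sym (evalTs-rename ag ts)))
  sat-rename ag (neg φ)     = mk⇔ (λ ¬s s → ¬s (from (sat-rename ag φ) s))
                                  (λ ¬s s → ¬s (to (sat-rename ag φ) s))
  sat-rename ag (conj φ ψ)  = sat-rename ag φ ×-⇔ sat-rename ag ψ
  sat-rename ag (exists φ)  = mk⇔
    (λ (x , s) → x , to (sat-rename (agree-lift x ag) φ) s)
    (λ (x , s) → x , from (sat-rename (agree-lift x ag) φ) s)

  sat-∧++ : ∀ {p q} (ψ : Formula L (suc p)) (χ : Formula L (suc q)) x u v →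
    Sat (ψ ∧++ χ) (x ∷ (u ++ v)) ⇔ (Sat ψ (x ∷ u) × Sat χ (x ∷ v))
  sat-∧++ ψ χ x u v =
    sat-rename (agree-lift x (agree-↑ˡ u v)) ψ ×-⇔ sat-rename (agree-lift x (agree-↑ʳ u v)) χ

  sat-existsⁿ : ∀ k {n} (φ : Formula L (k + n)) ρ →
    Sat (existsⁿ k φ) ρ ⇔ Σ (Vec |M| k) λ zs → Sat φ (zs ++ ρ)
  sat-existsⁿ zero    φ ρ = mk⇔ ([] ,_) λ { ([] , s) → s }
  sat-existsⁿ (suc k) φ ρ = mk⇔
    (λ s → let (zs , x , s′) = to (sat-existsⁿ k (exists φ) ρ) s in x ∷ zs , s′)
    λ { (x ∷ zs , s) → from (sat-existsⁿ k (exists φ) ρ) (zs , x , s) }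

  Algebraic : ∀ {n} → Formula L (suc n) → Vec |M| n → Set
  Algebraic φ ρ = Σ (List |M|) λ l → ∀ x → Sat φ (x ∷ ρ) → x ∈ l

  acl-mono : ∀ {X Y} → X ⊆ Y → acl X ⊆ acl Y
  acl-mono X⊆Y (n , φ , p , p∈X , s , alg) = n , φ , p , All.map X⊆Y p∈X , s , alg

  Covers₂ : Subset → Subset → Subset → Set
  Covers₂ A B C = ∀ {i j} (φ : Formula L (i + j)) (a : Vec |M| i) (b : Vec |M| j) →
    All A a → All B b → Σ (Vec |M| j) λ d → All C d × (Sat φ (a ++ b) → Sat φ (a ++ d))

  record Split (X Y : Subset) {p} (v : Vec |M| p) : Set where
    field
      {m n}    : ℕ
      xs       : Vec |M| m
      ys       : Vec |M| n
      xs∈      : All X xs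
      ys∈      : All Y ys
      position : Fin p → Fin (m + n)
      agrees   : Agree position (xs ++ ys) v

  split-∪ : ∀ {X Y p} {v : Vec |M| p} → All (X ∪ Y) v → Split X Y v
  split-∪ [] = record
    { xs = [] ; ys = [] ; xs∈ = [] ; ys∈ = [] ; position = λ () ; agrees = agree λ () }
  split-∪ {v = x ∷ _} (inj₁ x∈X ∷ v∈) = record
    { xs = x ∷ xs ; ys = ys ; xs∈ = x∈X ∷ xs∈ ; ys∈ = ys∈
    ; position = zero ∷ᶠ (suc ∘ position)
    ; agrees   = agree-∷ refl (agree-∘ (agree-suc (xs ++ ys)) agrees)
    }
    where open Split (split-∪ v∈)
  split-∪ {v = y ∷ _} (inj₂ y∈Y ∷ v∈) = record
    { xs = xs ; ys = y ∷ ys ; xs∈ = xs∈ ; ys∈ = y∈Y ∷ ys∈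
    ; position = (m ↑ʳ zero) ∷ᶠ (skip ∘ position)
    ; agrees   = agree-∷ (lookup-++ʳ xs (y ∷ ys) zero) (agree-∘ skip-agrees agrees)
    }
    where
    open Split (split-∪ v∈)
    skip : Fin (m + n) → Fin (m + suc n)
    skip = (_↑ˡ suc n) ++ᶠ ((m ↑ʳ_) ∘ suc)
    skip-agrees : Agree skip (xs ++ (y ∷ ys)) (xs ++ ys)
    skip-agrees =
      agree-++ (agree-↑ˡ xs (y ∷ ys)) (agree-∘ (agree-↑ʳ xs (y ∷ ys)) (agree-suc ys))

  covers-∪ : ∀ {A B C} → Covers A B C → Covers₂ (A ∪ C) (B ∪ C) C
  covers-∪ {C = C} cov {i} {j} φ a b a∈ b∈ = d , d∈C , transfer ∘ to-env SB.xs SB.agrees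
    where
    module SA = Split (split-∪ a∈)
    module SB = Split (split-∪ b∈)
    cs = SA.ys ++ SB.ys
    env : Vec |M| SB.m → Vec |M| (SA.m + (SB.m + (SA.n + SB.n)))
    env y = SA.xs ++ (y ++ cs)
    slot : Fin (i + j) → Fin (SA.m + (SB.m + (SA.n + SB.n)))
    slot = (((_↑ˡ _) ++ᶠ (λ z → SA.m ↑ʳ SB.m ↑ʳ (z ↑ˡ SB.n))) ∘ SA.position)
        ++ᶠ (((λ w → SA.m ↑ʳ (w ↑ˡ _)) ++ᶠ (λ z → SA.m ↑ʳ SB.m ↑ʳ SA.n ↑ʳ z)) ∘ SB.position)
    slot-agree : ∀ y {b′} → Agree SB.position (y ++ SB.ys) b′ → Agree slot (env y) (a ++ b′)
    slot-agree y ag = agree-++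
      (agree-∘ (agree-++ (agree-↑ˡ SA.xs (y ++ cs))
                         (agree-∘ (agree-↑ʳ SA.xs (y ++ cs))
                           (agree-∘ (agree-↑ʳ y cs) (agree-↑ˡ SA.ys SB.ys))))
               SA.agrees)
      (agree-∘ (agree-++ (agree-∘ (agree-↑ʳ SA.xs (y ++ cs)) (agree-↑ˡ y cs))
                         (agree-∘ (agree-↑ʳ SA.xs (y ++ cs))
                           (agree-∘ (agree-↑ʳ y cs) (agree-↑ʳ SA.ys SB.ys))))
               ag)
    to-env : ∀ y {b′} → Agree SB.position (y ++ SB.ys) b′ →
      Sat φ (a ++ b′) → Sat (rename slot φ) (env y)
    to-env y ag = from (sat-rename (slot-agree y ag) φ)
    covered = cov (rename slot φ) SA.xs SB.xs cs SA.xs∈ SB.xs∈ (++⁺ SA.ys∈ SB.ys∈)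
    d′ = proj₁ covered
    d : Vec |M| j
    d = tabulate (lookup (d′ ++ SB.ys) ∘ SB.position)
    d∈C : All C d
    d∈C = tabulate⁺ (lookup⁺ (++⁺ (proj₁ (proj₂ covered)) SB.ys∈) ∘ SB.position)
    transfer : Sat (rename slot φ) (env SB.xs) → Sat φ (a ++ d)
    transfer = to (sat-rename (slot-agree d′ (agree-tabulate SB.position (d′ ++ SB.ys))) φ)
             ∘ proj₂ (proj₂ covered)

  module _ (lem : ExcludedMiddle 0ℓ) where

    private
      dne : ∀ {P : Set} → ¬ ¬ P → P
      dne = em⇒dne lem

    sat-⋁ : ∀ k {n} (F : Fin k → Formula L n) ρ → Sat (⋁ k F) ρ ⇔ (∃[ i ] Sat (F i) ρ)
    sat-⋁ zero    F ρ = mk⇔ (λ ()) (λ ())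
    sat-⋁ (suc k) F ρ = mk⇔ pick unpick
      where
      unpick : ∃[ i ] Sat (F i) ρ → Sat (⋁ (suc k) F) ρ
      unpick (zero  , s) (¬s , _)  = ¬s s
      unpick (suc i , s) (_  , ¬r) = ¬r (from (sat-⋁ k (F ∘ suc) ρ) (i , s))
      pick : Sat (⋁ (suc k) F) ρ → ∃[ i ] Sat (F i) ρ
      pick s∨ with lem {Sat (F zero) ρ}
      ... | yes s = zero , s
      ... | no ¬s =
        let (i , s) = to (sat-⋁ k (F ∘ suc) ρ) (dne λ ¬r → s∨ (¬s , ¬r)) in suc i , s

    sat-isAmong : ∀ k {n} x (zs : Vec |M| k) (ρ : Vec |M| n) →
      Sat (isAmong k) (x ∷ (zs ++ ρ)) ⇔ x ∈ᵥ zs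
    sat-isAmong k x zs ρ = mk⇔
      (λ s → let (i , x≡) = to (sat-⋁ k _ (x ∷ (zs ++ ρ))) s in
             subst (_∈ᵥ zs) (sym (trans x≡ (lookup-++ˡ zs ρ i))) (∈-lookup i zs))
      (λ x∈ → let i = VecAny.index x∈ in
              from (sat-⋁ k _ (x ∷ (zs ++ ρ)))
                   (i , trans (lookup-index x∈) (sym (lookup-++ˡ zs ρ i))))

    sat-atMost : ∀ k {n} (φ : Formula L (suc n)) ρ →
      Sat (atMost k φ) ρ ⇔ Σ (Vec |M| k) λ zs → ∀ x → Sat φ (x ∷ ρ) → x ∈ᵥ zs
    sat-atMost k φ ρ = mk⇔
      (λ s → let (zs , ∄) = to (sat-existsⁿ k _ ρ) s in
             zs , λ x sφ → dne λ x∉ →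
               ∄ (x , from (φ-at x zs) sφ , x∉ ∘ to (sat-isAmong k x zs ρ)))
      (λ (zs , covered) → from (sat-existsⁿ k _ ρ) (zs , λ (x , sφ , x∉) →
        x∉ (from (sat-isAmong k x zs ρ) (covered x (to (φ-at x zs) sφ)))))
      where
      φ-at : ∀ x zs → Sat (rename (lift 1 (k ↑ʳ_)) φ) (x ∷ (zs ++ ρ)) ⇔ Sat φ (x ∷ ρ)
      φ-at x zs = sat-rename (agree-lift x (agree-↑ʳ zs ρ)) φ

    minimise : ∀ {W : Set} (μ : W → ℕ) → W → Σ W λ w → ∀ w′ → ¬ μ w′ < μ w
    minimise {W} μ w₀ = <-rec P step (μ w₀) w₀ refl
      where
      P : ℕ → Set
      P n = ∀ w → μ w ≡ n → Σ W λ w → ∀ w′ → ¬ μ w′ < μ w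
      step : ∀ n → (∀ {m} → m < n → P m) → P n
      step _ rec w refl with lem {Σ W λ w′ → μ w′ < μ w}
      ... | yes (w′ , smaller) = rec smaller w′ refl
      ... | no ∄               = w , λ w′ smaller → ∄ (w′ , smaller)

    record AclWitness (X : Subset) (e : |M|) : Set where
      field
        arity     : ℕ
        formula   : Formula L (suc arity)
        params    : Vec |M| arity
        params∈   : All X params
        holds     : Sat formula (e ∷ params)
        algebraic : Algebraic formula params

      size : ℕ
      size = length (proj₁ algebraic)

    fromAcl : ∀ {X e} → acl X e → AclWitness X e
    fromAcl (n , φ , p , p∈X , s , alg) = record
      { arity = n ; formula = φ ; params = p ; params∈ = p∈X ; holds = s ; algebraic = alg }

    Minimal : ∀ {X e} → AclWitness X e → Set
    Minimal {X} {e} w = ∀ (w′ : AclWitness X e) → ¬ AclWitness.size w′ < AclWitness.size w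

    minimal-isolates : ∀ {X e} (w : AclWitness X e) → Minimal w →
      let open AclWitness w in
      ∀ {r} (χ : Formula L (suc r)) q → All X q → Sat χ (e ∷ q) →
      ∀ e′ → Sat formula (e′ ∷ params) → Sat χ (e′ ∷ q)
    minimal-isolates {X} {e} w minimal {r} χ q q∈X χe e′ ψe′ =
      dne λ ¬χe′ → minimal (narrower ¬χe′) (filter-notAll ≢e′? l e′-excluded)
      where
      open AclWitness w
      l = proj₁ algebraic
      complete = proj₂ algebraic
      ≢e′? = λ x → ¬? (lem {x ≡ e′})
      e′-excluded = ListAny.map (λ e′≡x x≢e′ → x≢e′ (sym e′≡x)) (complete e′ ψe′)
      narrower : ¬ Sat χ (e′ ∷ q) → AclWitness X e
      narrower ¬χe′ = record
        { arity     = arity + r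
        ; formula   = formula ∧++ χ
        ; params    = params ++ q
        ; params∈   = ++⁺ params∈ q∈X
        ; holds     = from (sat-∧++ formula χ e params q) (holds , χe)
        ; algebraic = filter ≢e′? l , λ x s →
            let (ψx , χx) = to (sat-∧++ formula χ x params q) s in
            ∈-filter⁺ ≢e′? (complete x ψx) λ { refl → ¬χe′ χx }
        }

    covers-shared-solution : ∀ {A B C e} → Covers₂ A B C → (w : AclWitness A e) →
      let open AclWitness w in
      ∀ {q} (φ : Formula L (suc q)) b → All B b → Sat φ (e ∷ b) → Algebraic φ b →
      Σ (Vec |M| q) λ d → All C d ×
        (Σ |M| λ e′ → Sat formula (e′ ∷ params) × Sat φ (e′ ∷ d)) × Algebraic φ d
    covers-shared-solution cov w φ b b∈B φe (l , complete) =
      let (d , d∈C , transfer) = cov θ params b params∈ b∈B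
          ((e′ , s) , bound) = transfer θ-b
          (zs , complete′) = to (sat-atMost n φ d) (to (bound-at d) bound)
      in d , d∈C , (e′ , to (sat-∧++ formula φ e′ params d) s) ,
         toList zs , λ x s → ∈-toList⁺ (complete′ x s)
      where
      open AclWitness w
      n = length l
      θ = conj (exists (formula ∧++ φ)) (rename (arity ↑ʳ_) (atMost n φ))
      bound-at : ∀ b′ →
        Sat (rename (arity ↑ʳ_) (atMost n φ)) (params ++ b′) ⇔ Sat (atMost n φ) b′
      bound-at b′ = sat-rename (agree-↑ʳ params b′) (atMost n φ)
      θ-b : Sat θ (params ++ b)
      θ-b = (_ , from (sat-∧++ formula φ _ params b) (holds , φe))
          , from (bound-at b)
                 (from (sat-atMost n φ b) (fromList l , λ x s → ∈-fromList⁺ (complete x s)))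

    acl-∩⊆acl : ∀ {A B C} → Covers A B C → acl (A ∪ C) ∩ acl (B ∪ C) ⊆ acl C
    acl-∩⊆acl cov {e} (e∈AC , (q , φ , b , b∈BC , φe , alg)) =
      let (w , minimal) = minimise AclWitness.size (fromAcl e∈AC)
          (d , d∈C , (e′ , ψe′ , φe′) , alg-d) =
            covers-shared-solution (covers-∪ cov) w φ b b∈BC φe alg
          φe-d = dne λ ¬φe-d →
            minimal-isolates w minimal (neg φ) d (All.map inj₂ d∈C) ¬φe-d e′ ψe′ φe′
      in q , φ , d , d∈C , φe-d , alg-d

lemma6p5 : ExcludedMiddle 0ℓ → (L : Signature) → (M : Structure L) →
    Semantics.Saturated M →
    (A B C : Semantics.Subset M) →
    Semantics.Small M A → Semantics.Small M B → Semantics.Small M C →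
    Semantics.Covers M A B C → Semantics.IndepA M A B C
lemma6p5 lem L M _ A B C _ _ _ cov =
  acl-∩⊆acl M lem cov , < acl-mono M inj₂ , acl-mono M inj₂ >
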